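{- Let $G=(V,E)$ be a graph on $n$ vertices with $\delta(G)\ge\frac12(n-1)+t$ for some real number $t$. Let $\alpha\in[0,1]$ and let $a,b$ be positive integers with $a+b=n$. Then either there exists $A\subseteq V$ with $|A|=a$ and $\delta(G[A])\ge\frac12 a-1+\alpha t$, or there exists $B\subseteq V$ with $|B|=b$ and $\delta(G[B])\ge \frac12 b-1+(1-\alpha)t$.
   Context: $\delta(\cdot)$ denotes minimum degree and $G[X]$ the subgraph of $G$ induced by $X$. Graphs are finite and simple.
   Formalization: The parameters t and α are rational rather than real, with α ranging over the rationals in [0,1]. -}

module Defs where

open import Data.Nat using (ℕ)
open import Data.Bool using (Bool; true; false)
open import Data.Fin using (Fin)
open import Data.Fin.Subset using (Subset; _∈_; _∩_; ∣_∣)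
open import Data.Vec using (tabulate)
open import Data.Integer using (+_)
open import Data.Rational using (ℚ; _/_; _≤_)
open import Relation.Binary.PropositionalEquality using (_≡_)

record Graph (n : ℕ) : Set where
  field
    adj   : Fin n → Fin n → Bool
    sym   : ∀ u v → adj u v ≡ adj v u
    irrefl : ∀ v → adj v v ≡ false
open Graph public

ℕ→ℚ : ℕ → ℚ
ℕ→ℚ k = + k / 1

N : ∀ {n} → Graph n → Fin n → Subset n
N G v = tabulate (adj G v)

degIn : ∀ {n} → Graph n → Subset n → Fin n → ℕ
degIn G X v = ∣ N G v ∩ X ∣

-- δ(G[X]) ≥ x  (for nonempty X): every vertex of X has degree ≥ x in G[X].
minDeg≥ : ∀ {n} → Graph n → Subset n → ℚ → Set
minDeg≥ G X x = ∀ v → v ∈ X → x ≤ ℕ→ℚ (degIn G X v)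

V : ∀ {n} → Subset n
V = tabulate (λ _ → true)

{-# OPTIONS --safe #-}
-- Among all partitions V = A ∪ B with |A| = a, take one with the fewest A–B edges. Suppose
-- v ∈ A has fewer than Lᴬ = a/2 − 1 + αt neighbours in A and w ∈ B fewer than
-- Lᴮ = b/2 − 1 + (1 − α)t neighbours in B. Every degree is at least
-- (n − 1)/2 + t = Lᴬ + Lᴮ + 3/2, so d_A(v) + d_B(w) + 3 < d_B(v) + d_A(w). Exchanging v and w
-- changes the number of A–B edges by d_A(v) + d_B(w) − d_B(v) − d_A(w) + 2[vw ∈ E] < 0,
-- contradicting minimality.
module Submission where

open import Defs hiding (sym)
open import Data.Nat using (ℕ; _+_; NonZero)
open import Data.Product using (Σ; _×_)
open import Data.Sum using (_⊎_)
open import Data.Fin.Subset using (Subset; ∣_∣)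
open import Data.Rational using (ℚ; _≤_; ½; 0ℚ; 1ℚ; _-_; _*_) renaming (_+_ to _+ℚ_)
open import Relation.Binary.PropositionalEquality using (_≡_)

open import Data.Bool using (Bool; true; false; not; _∧_; if_then_else_)
import Data.Bool.Properties as BoolP
open import Data.Fin using (Fin; zero; suc; punchIn)
open import Data.Fin.Properties using (any?; punchInᵢ≢i)
open import Data.Fin.Subset using (_∈_; _∩_; ∁)
open import Data.Fin.Subset.Properties using (∣∁p∣≡n∸∣p∣)
import Data.Integer as ℤ
import Data.Integer.Properties as ℤP
import Data.Nat as ℕ
open import Data.Nat using (zero; suc; _∸_; z≤n; s≤s)
import Data.Nat.Properties as ℕP
import Data.Nat.Tactic.RingSolver as ℕ-Solver
open import Data.Nat.Coprimality using (1-coprimeTo) renaming (sym to coprime-sym)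
open import Data.Nat.Induction using (<-wellFounded)
open import Data.Product using (∃; _,_)
open import Data.Rational using (mkℚ; _<_; _/_)
import Data.Rational.Properties as ℚP
open import Data.Rational.Solver using (module +-*-Solver)
open import Data.Sum using (inj₁; inj₂; map₂)
open import Data.Vec using (tabulate; _∷_)
import Data.Vec.Functional as Vector
open import Data.Vec.Functional using (removeAt; updateAt)
open import Data.Vec.Functional.Properties using (updateAt-updates; updateAt-minimal)
open import Data.Vec.Properties using (lookup∘tabulate; []=⇒lookup; lookup⇒[]=; tabulate-∘)
open import Function using (_∘_; const; case_of_)
open import Induction.WellFounded using (Acc; acc)
open import Relation.Binary.PropositionalEquality
  using (_≢_; _≗_; refl; sym; trans; cong; cong₂; subst; subst₂; module ≡-Reasoning)
open import Relation.Nullary using (yes; no)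
open import Relation.Nullary.Decidable using (_×-dec_)

open +-*-Solver using (solve; _:=_; _:+_; _:*_; _:-_; con)
open import Algebra.Properties.CommutativeMonoid.Sum ℕP.+-0-commutativeMonoid
  using (sum; sum-cong-≗; ∑-distrib-+; sum-remove; sum-replicate-zero)

infix 4 _≗_except_

_≗_except_ : ∀ {n} {A : Set} → (Fin n → A) → (Fin n → A) → Fin n → Set
f ≗ g except p = ∀ u → u ≢ p → f u ≡ g u

not-except : ∀ {n} {X Y : Fin n → Bool} {p} → X ≗ Y except p → not ∘ Y ≗ not ∘ X except p
not-except X≗Y u u≢p = cong not (sym (X≗Y u u≢p))

sum-except : ∀ {n} {f g : Fin n → ℕ} (p : Fin n) → f ≗ g except p → sum f + g p ≡ sum g + f p
sum-except {suc n} {f} {g} p f≗g = begin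
  sum f + g p                     ≡⟨ cong (_+ g p) (sum-remove {i = p} f) ⟩
  f p + sum (removeAt f p) + g p  ≡⟨ cong (λ s → f p + s + g p) (sum-cong-≗ off-p) ⟩
  f p + sum (removeAt g p) + g p  ≡⟨ swap-ends (f p) _ (g p) ⟩
  g p + sum (removeAt g p) + f p  ≡⟨ cong (_+ f p) (sum-remove {i = p} g) ⟨
  sum g + f p                     ∎
  where
  open ≡-Reasoning
  off-p : removeAt f p ≗ removeAt g p
  off-p j = f≗g (punchIn p j) (punchInᵢ≢i p j)
  swap-ends : ∀ x y z → x + y + z ≡ z + y + x
  swap-ends = ℕ-Solver.solve-∀

𝟙 : Bool → ℕ
𝟙 true  = 1
𝟙 false = 0

count : ∀ {n} → (Fin n → Bool) → ℕ
count X = sum (𝟙 ∘ X)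

count-move : ∀ {n} {X Y : Fin n → Bool} {p} → X ≗ Y except p → X p ≡ true → Y p ≡ false →
             count X ≡ suc (count Y)
count-move {X = X} {Y} {p} X≗Y Xp Yp = begin
  count X            ≡⟨ ℕP.+-identityʳ (count X) ⟨
  count X + 𝟙 false  ≡⟨ cong (λ b → count X + 𝟙 b) Yp ⟨
  count X + 𝟙 (Y p)  ≡⟨ sum-except p (λ u u≢p → cong 𝟙 (X≗Y u u≢p)) ⟩
  count Y + 𝟙 (X p)  ≡⟨ cong (λ b → count Y + 𝟙 b) Xp ⟩
  count Y + 1        ≡⟨ ℕP.+-comm (count Y) 1 ⟩
  suc (count Y)      ∎
  where open ≡-Reasoning

∃-count≡ : ∀ {n a} → a ℕ.≤ n → ∃ λ (X : Fin n → Bool) → count X ≡ a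
∃-count≡ {n} z≤n     = const false , sum-replicate-zero n
∃-count≡ (s≤s a≤n) with X , count≡a ← ∃-count≡ a≤n = true Vector.∷ X , cong suc count≡a

∣tabulate∣≡count : ∀ {n} (X : Fin n → Bool) → ∣ tabulate X ∣ ≡ count X
∣tabulate∣≡count {zero}  X = refl
∣tabulate∣≡count {suc n} X with X zero
... | true  = cong suc (∣tabulate∣≡count (X ∘ suc))
... | false = ∣tabulate∣≡count (X ∘ suc)

∣tabulate-not∣ : ∀ {n a} (X : Fin n → Bool) → count X ≡ a → ∣ tabulate (not ∘ X) ∣ ≡ n ∸ a
∣tabulate-not∣ {n} {a} X X-size = begin
  ∣ tabulate (not ∘ X) ∣  ≡⟨ cong ∣_∣ (tabulate-∘ not X) ⟩
  ∣ ∁ (tabulate X) ∣      ≡⟨ ∣∁p∣≡n∸∣p∣ (tabulate X) ⟩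
  n ∸ ∣ tabulate X ∣      ≡⟨ cong (n ∸_) (trans (∣tabulate∣≡count X) X-size) ⟩
  n ∸ a                   ∎
  where open ≡-Reasoning

tabulate-∩ : ∀ {n} (X Y : Fin n → Bool) → tabulate X ∩ tabulate Y ≡ tabulate (λ u → X u ∧ Y u)
tabulate-∩ {zero}  X Y = refl
tabulate-∩ {suc n} X Y = cong (X zero ∧ Y zero ∷_) (tabulate-∩ (X ∘ suc) (Y ∘ suc))

∈-tabulate⁻ : ∀ {n} (X : Fin n → Bool) {v} → v ∈ tabulate X → X v ≡ true
∈-tabulate⁻ X {v} v∈X = trans (sym (lookup∘tabulate X v)) ([]=⇒lookup v∈X)

∈-V : ∀ {n} (v : Fin n) → v ∈ V
∈-V v = lookup⇒[]= v V (lookup∘tabulate (const true) v)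

exchange : ∀ {n} → (Fin n → Bool) → Fin n → Fin n → Fin n → Bool
exchange X v w = updateAt (updateAt X v (const false)) w (const true)

module Exchange {n} (X : Fin n → Bool) {v w} (Xv : X v ≡ true) (Xw : X w ≡ false) where

  X₁ : Fin n → Bool
  X₁ = updateAt X v (const false)

  X≗X₁ : X ≗ X₁ except v
  X≗X₁ u u≢v = sym (updateAt-minimal u v X u≢v)

  X₁v : X₁ v ≡ false
  X₁v = updateAt-updates v X

  X₁w : X₁ w ≡ false
  X₁w = trans (updateAt-minimal w v X w≢v) Xw
    where
    w≢v : w ≢ v
    w≢v refl with () ← trans (sym Xv) Xw

  exchange≗X₁ : exchange X v w ≗ X₁ except w
  exchange≗X₁ u u≢w = updateAt-minimal u w X₁ u≢w

  exchange-w : exchange X v w w ≡ true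
  exchange-w = updateAt-updates w X₁

count-exchange : ∀ {n} (X : Fin n → Bool) {v w} → X v ≡ true → X w ≡ false →
                 count (exchange X v w) ≡ count X
count-exchange X Xv Xw =
  trans (count-move exchange≗X₁ exchange-w X₁w) (sym (count-move X≗X₁ Xv X₁v))
  where open Exchange X Xv Xw

ℕ→ℚ≡mkℚ : ∀ m → ℕ→ℚ m ≡ mkℚ (ℤ.+ m) 0 (coprime-sym (1-coprimeTo m))
ℕ→ℚ≡mkℚ m = ℚP.normalize-coprime (coprime-sym (1-coprimeTo m))

ℕ→ℚ-+ : ∀ m k → ℕ→ℚ (m + k) ≡ ℕ→ℚ m +ℚ ℕ→ℚ k
ℕ→ℚ-+ m k rewrite ℕ→ℚ≡mkℚ m | ℕ→ℚ≡mkℚ k =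
  cong (_/ 1) (sym (cong₂ ℤ._+_ (ℤP.*-identityʳ (ℤ.+ m)) (ℤP.*-identityʳ (ℤ.+ k))))

ℕ→ℚ-cancel-< : ∀ {m k} → ℕ→ℚ m < ℕ→ℚ k → m ℕ.< k
ℕ→ℚ-cancel-< {m} {k} m<k = ℤP.drop‿+<+
  (subst₂ ℤ._<_ (ℤP.*-identityʳ (ℤ.+ m)) (ℤP.*-identityʳ (ℤ.+ k))
    (ℚP.drop-*<* (subst₂ _<_ (ℕ→ℚ≡mkℚ m) (ℕ→ℚ≡mkℚ k) m<k)))

-- ½ is abstracted to h so that the solver never normalises rational constants;
-- the leftover h + h − 1 then computes to 0 at h = ½.
double-1½ : ∀ p → p +ℚ p +ℚ ℕ→ℚ 3 ≡ p +ℚ (1ℚ +ℚ ½) +ℚ (p +ℚ (1ℚ +ℚ ½))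
double-1½ p = trans (sym (ℚP.+-identityʳ _)) (identity p ½)
  where
  identity : ∀ p h → p +ℚ p +ℚ (1ℚ +ℚ 1ℚ +ℚ 1ℚ) +ℚ (h +ℚ h - 1ℚ) ≡ p +ℚ (1ℚ +ℚ h) +ℚ (p +ℚ (1ℚ +ℚ h))
  identity = solve 2 (λ p h → p :+ p :+ (con 1ℚ :+ con 1ℚ :+ con 1ℚ) :+ (h :+ h :- con 1ℚ)
                              := p :+ (con 1ℚ :+ h) :+ (p :+ (con 1ℚ :+ h))) refl

degree-gap : ∀ {x x′ y y′ : ℕ} {L₁ L₂ D : ℚ} → L₁ +ℚ L₂ +ℚ (1ℚ +ℚ ½) ≤ D →
             ℕ→ℚ x < L₁ → ℕ→ℚ y < L₂ → D ≤ ℕ→ℚ (x + x′) → D ≤ ℕ→ℚ (y′ + y) →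
             x + y + 3 ℕ.< x′ + y′
degree-gap {x} {x′} {y} {y′} {L₁} {L₂} {D} budget x<L₁ y<L₂ D≤x+x′ D≤y′+y =
  ℕP.+-cancelˡ-< (x + y) (x + y + 3) (x′ + y′)
    (subst₂ ℕ._<_ (ℕP.+-assoc (x + y) (x + y) 3) (shuffle x x′ y y′) (ℕ→ℚ-cancel-< (begin-strict
      ℕ→ℚ (x + y + (x + y) + 3)                          ≡⟨ doubled ⟩
      S +ℚ S                                              <⟨ ℚP.+-mono-< S<L S<L ⟩
      L₁ +ℚ L₂ +ℚ (1ℚ +ℚ ½) +ℚ (L₁ +ℚ L₂ +ℚ (1ℚ +ℚ ½))  ≤⟨ ℚP.+-mono-≤ budget budget ⟩
      D +ℚ D                                              ≤⟨ ℚP.+-mono-≤ D≤x+x′ D≤y′+y ⟩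
      ℕ→ℚ (x + x′) +ℚ ℕ→ℚ (y′ + y)                        ≡⟨ ℕ→ℚ-+ (x + x′) (y′ + y) ⟨
      ℕ→ℚ (x + x′ + (y′ + y))                             ∎)))
  where
  open ℚP.≤-Reasoning
  S : ℚ
  S = ℕ→ℚ x +ℚ ℕ→ℚ y +ℚ (1ℚ +ℚ ½)
  S<L : S < L₁ +ℚ L₂ +ℚ (1ℚ +ℚ ½)
  S<L = ℚP.+-mono-<-≤ (ℚP.+-mono-< x<L₁ y<L₂) ℚP.≤-refl
  doubled : ℕ→ℚ (x + y + (x + y) + 3) ≡ S +ℚ S
  doubled rewrite ℕ→ℚ-+ (x + y + (x + y)) 3 | ℕ→ℚ-+ (x + y) (x + y) | ℕ→ℚ-+ x y =
    double-1½ (ℕ→ℚ x +ℚ ℕ→ℚ y)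
  shuffle : ∀ x x′ y y′ → x + x′ + (y′ + y) ≡ x + y + (x′ + y′)
  shuffle = ℕ-Solver.solve-∀

descend : ∀ {A : Set} {P Q : A → Set} (μ : A → ℕ) →
          (∀ x → P x → Q x ⊎ ∃ λ y → P y × μ y ℕ.< μ x) →
          ∀ x → P x → ∃ λ y → P y × Q y
descend {P = P} {Q} μ step x Px = go x Px (<-wellFounded (μ x))
  where
  go : ∀ x → P x → Acc ℕ._<_ (μ x) → ∃ λ y → P y × Q y
  go x Px (acc smaller) with step x Px
  ... | inj₁ Qx             = x , Px , Qx
  ... | inj₂ (y , Py , y<x) = go y Py (smaller y<x)

module _ {n} (G : Graph n) where

  deg : (Fin n → Bool) → Fin n → ℕ
  deg Y v = count (λ u → Y u ∧ adj G v u)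

  degIn-tabulate : ∀ Y v → degIn G (tabulate Y) v ≡ deg Y v
  degIn-tabulate Y v = begin
    ∣ tabulate (adj G v) ∩ tabulate Y ∣   ≡⟨ cong ∣_∣ (tabulate-∩ (adj G v) Y) ⟩
    ∣ tabulate (λ u → adj G v u ∧ Y u) ∣  ≡⟨ ∣tabulate∣≡count (λ u → adj G v u ∧ Y u) ⟩
    count (λ u → adj G v u ∧ Y u)         ≡⟨ sum-cong-≗ (λ u → cong 𝟙 (BoolP.∧-comm (adj G v u) (Y u))) ⟩
    deg Y v                               ∎
    where open ≡-Reasoning

  deg-split : ∀ X v → deg (const true) v ≡ deg X v + deg (not ∘ X) v
  deg-split X v = trans (sum-cong-≗ split) (∑-distrib-+ (λ u → 𝟙 (X u ∧ adj G v u)) _)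
    where
    split : ∀ u → 𝟙 (adj G v u) ≡ 𝟙 (X u ∧ adj G v u) + 𝟙 (not (X u) ∧ adj G v u)
    split u with X u
    ... | true  = sym (ℕP.+-identityʳ _)
    ... | false = refl

  deg-move : ∀ {X Y p} → X ≗ Y except p → X p ≡ true → Y p ≡ false →
             ∀ w → deg X w ≡ deg Y w + 𝟙 (adj G w p)
  deg-move {X} {Y} {p} X≗Y Xp Yp w = begin
    deg X w                          ≡⟨ ℕP.+-identityʳ (deg X w) ⟨
    deg X w + 𝟙 (false ∧ adj G w p)  ≡⟨ cong (λ b → deg X w + 𝟙 (b ∧ adj G w p)) Yp ⟨
    deg X w + 𝟙 (Y p ∧ adj G w p)    ≡⟨ sum-except p (λ u u≢p → cong (λ b → 𝟙 (b ∧ adj G w u)) (X≗Y u u≢p)) ⟩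
    deg Y w + 𝟙 (X p ∧ adj G w p)    ≡⟨ cong (λ b → deg Y w + 𝟙 (b ∧ adj G w p)) Xp ⟩
    deg Y w + 𝟙 (adj G w p)          ∎
    where open ≡-Reasoning

  deg-move-self : ∀ {X Y p} → X ≗ Y except p → X p ≡ true → Y p ≡ false → deg X p ≡ deg Y p
  deg-move-self {X} {Y} {p} X≗Y Xp Yp = begin
    deg X p                  ≡⟨ deg-move X≗Y Xp Yp p ⟩
    deg Y p + 𝟙 (adj G p p)  ≡⟨ cong (λ b → deg Y p + 𝟙 b) (irrefl G p) ⟩
    deg Y p + 0              ≡⟨ ℕP.+-identityʳ (deg Y p) ⟩
    deg Y p                  ∎
    where open ≡-Reasoning

  cut : (Fin n → Bool) → ℕ
  cut X = sum (λ v → if X v then deg (not ∘ X) v else 0)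

  cut-move : ∀ {X Y p} → X ≗ Y except p → X p ≡ true → Y p ≡ false →
             cut X + deg Y p ≡ cut Y + deg (not ∘ X) p
  cut-move {X} {Y} {p} X≗Y Xp Yp = begin
    cut X + deg Y p          ≡⟨ ∑-distrib-+ (λ v → if X v then deg (not ∘ X) v else 0) _ ⟨
    sum f                    ≡⟨ ℕP.+-identityʳ (sum f) ⟨
    sum f + 0                ≡⟨ cong (λ b → sum f + (if b then deg (not ∘ Y) p else 0)) Yp ⟨
    sum f + g p              ≡⟨ sum-except p agree ⟩
    cut Y + f p              ≡⟨ cong (λ d → cut Y + d) f-at-p ⟩
    cut Y + deg (not ∘ X) p  ∎
    where
    open ≡-Reasoning
    f g : Fin n → ℕ
    f v = (if X v then deg (not ∘ X) v else 0) + 𝟙 (Y v ∧ adj G p v)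
    g v = if Y v then deg (not ∘ Y) v else 0
    f-at-p : f p ≡ deg (not ∘ X) p
    f-at-p rewrite Xp | Yp = ℕP.+-identityʳ _
    agree : f ≗ g except p
    agree v v≢p
      rewrite X≗Y v v≢p
            | deg-move (not-except X≗Y) (cong not Yp) (cong not Xp) v
            | Graph.sym G p v
      with Y v
    ... | true  = refl
    ... | false = refl

  cut-exchange : ∀ {X v w} → X v ≡ true → X w ≡ false →
    let k = 𝟙 (adj G w v) in
    cut (exchange X v w) + (deg (not ∘ X) v + deg X w) ≡ cut X + deg X v + (deg (not ∘ X) w + k + k)
  cut-exchange {X} {v} {w} Xv Xw = begin
    cut Z + (deg X̄ v + deg X w)           ≡⟨ cong (λ d → cut Z + (deg X̄ v + d)) (deg-move X≗X₁ Xv X₁v w) ⟩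
    cut Z + (deg X̄ v + (deg X₁ w + k))    ≡⟨ regroup (cut Z) (deg X̄ v) (deg X₁ w) k ⟩
    cut Z + deg X₁ w + (deg X̄ v + k)      ≡⟨ cong (_+ (deg X̄ v + k)) (cut-move exchange≗X₁ exchange-w X₁w) ⟩
    cut X₁ + deg Z̄ w + (deg X̄ v + k)      ≡⟨ regroup′ (cut X₁) (deg Z̄ w) (deg X̄ v) k ⟩
    cut X₁ + deg X̄ v + (deg Z̄ w + k)      ≡⟨ cong₂ (λ c d → c + (d + k)) (cut-move X≗X₁ Xv X₁v) Z̄w ⟨
    cut X + deg X₁ v + (deg X̄ w + k + k)  ≡⟨ cong (λ d → cut X + d + (deg X̄ w + k + k)) (deg-move-self X≗X₁ Xv X₁v) ⟨
    cut X + deg X v + (deg X̄ w + k + k)   ∎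
    where
    open ≡-Reasoning
    open Exchange X Xv Xw
    Z X̄ Z̄ : Fin n → Bool
    Z = exchange X v w
    X̄ = not ∘ X
    Z̄ = not ∘ Z
    k : ℕ
    k = 𝟙 (adj G w v)
    Z̄w : deg X̄ w + k ≡ deg Z̄ w
    Z̄w = begin
      deg X̄ w + k       ≡⟨ deg-move (not-except X≗X₁) (cong not X₁v) (cong not Xv) w ⟨
      deg (not ∘ X₁) w  ≡⟨ deg-move-self (not-except exchange≗X₁) (cong not X₁w) (cong not exchange-w) ⟩
      deg Z̄ w           ∎
    regroup : ∀ a b c d → a + (b + (c + d)) ≡ a + c + (b + d)
    regroup = ℕ-Solver.solve-∀
    regroup′ : ∀ a b c d → a + b + (c + d) ≡ a + c + (b + d)
    regroup′ = ℕ-Solver.solve-∀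

  cut-exchange-< : ∀ {X v w} → X v ≡ true → X w ≡ false →
                   deg X v + deg (not ∘ X) w + 3 ℕ.< deg (not ∘ X) v + deg X w →
                   cut (exchange X v w) ℕ.< cut X
  cut-exchange-< {X} {v} {w} Xv Xw gap = ℕP.+-cancelʳ-< P (cut (exchange X v w)) (cut X) (begin-strict
    cut (exchange X v w) + P  ≡⟨ cut-exchange Xv Xw ⟩
    cut X + a + (b + k + k)   ≤⟨ ℕP.+-monoʳ-≤ (cut X + a) (ℕP.+-mono-≤ (ℕP.+-monoʳ-≤ b (𝟙≤1 _)) (𝟙≤1 _)) ⟩
    cut X + a + (b + 1 + 1)   ≡⟨ regroup (cut X) a b ⟩
    cut X + (a + b + 2)       <⟨ ℕP.+-monoʳ-< (cut X) (ℕP.<-trans (ℕP.+-monoʳ-< (a + b) (ℕP.n<1+n 2)) gap) ⟩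
    cut X + P                 ∎)
    where
    open ℕP.≤-Reasoning
    a b k P : ℕ
    a = deg X v
    b = deg (not ∘ X) w
    k = 𝟙 (adj G w v)
    P = deg (not ∘ X) v + deg X w
    𝟙≤1 : ∀ x → 𝟙 x ℕ.≤ 1
    𝟙≤1 true  = s≤s z≤n
    𝟙≤1 false = z≤n
    regroup : ∀ c a b → c + a + (b + 1 + 1) ≡ c + (a + b + 2)
    regroup = ℕ-Solver.solve-∀

  MinDeg≥ : (Fin n → Bool) → ℚ → Set
  MinDeg≥ X L = ∀ v → X v ≡ true → L ≤ ℕ→ℚ (deg X v)

  minDeg≥-or-deficient : ∀ X L → MinDeg≥ X L ⊎ ∃ λ v → X v ≡ true × ℕ→ℚ (deg X v) < L
  minDeg≥-or-deficient X L =
    case any? (λ v → (X v BoolP.≟ true) ×-dec (ℕ→ℚ (deg X v) ℚP.<? L)) of λ where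
      (yes deficient) → inj₂ deficient
      (no ¬deficient) → inj₁ λ v Xv → ℚP.≮⇒≥ (λ low → ¬deficient (v , Xv , low))

  minDeg≥-tabulate : ∀ {X L} → MinDeg≥ X L → minDeg≥ G (tabulate X) L
  minDeg≥-tabulate {X} {L} good v v∈X =
    subst (λ d → L ≤ ℕ→ℚ d) (sym (degIn-tabulate X v)) (good v (∈-tabulate⁻ X v∈X))

  minDeg≥V⇒≤deg+deg∁ : ∀ {D} → minDeg≥ G V D → ∀ X v → D ≤ ℕ→ℚ (deg X v + deg (not ∘ X) v)
  minDeg≥V⇒≤deg+deg∁ {D} δ≥D X v =
    subst (λ d → D ≤ ℕ→ℚ d) (trans (degIn-tabulate (const true) v) (deg-split X v)) (δ≥D v (∈-V v))

  balanced-or-improvable : ∀ {Lᴬ Lᴮ D a} → Lᴬ +ℚ Lᴮ +ℚ (1ℚ +ℚ ½) ≤ D → minDeg≥ G V D →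
    ∀ X → count X ≡ a →
    (MinDeg≥ X Lᴬ ⊎ MinDeg≥ (not ∘ X) Lᴮ) ⊎ ∃ λ Y → count Y ≡ a × cut Y ℕ.< cut X
  balanced-or-improvable {Lᴬ} {Lᴮ} budget δ≥D X X-size =
    case minDeg≥-or-deficient X Lᴬ , minDeg≥-or-deficient (not ∘ X) Lᴮ of λ where
      (inj₁ goodA , _)          → inj₁ (inj₁ goodA)
      (inj₂ _     , inj₁ goodB) → inj₁ (inj₂ goodB)
      (inj₂ (v , Xv , v-low) , inj₂ (w , X̄w , w-low)) →
        let Xw : X w ≡ false
            Xw = BoolP.not-injective X̄w
        in inj₂ (exchange X v w , trans (count-exchange X Xv Xw) X-size ,
                 cut-exchange-< Xv Xw (degree-gap {deg X v} {deg (not ∘ X) v} {deg (not ∘ X) w} {deg X w}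
                   budget v-low w-low (minDeg≥V⇒≤deg+deg∁ δ≥D X v) (minDeg≥V⇒≤deg+deg∁ δ≥D X w)))

  balanced-partition : ∀ {Lᴬ Lᴮ D} → Lᴬ +ℚ Lᴮ +ℚ (1ℚ +ℚ ½) ≤ D → minDeg≥ G V D →
    ∀ {a} → a ℕ.≤ n →
    (Σ (Subset n) λ A → ∣ A ∣ ≡ a × minDeg≥ G A Lᴬ) ⊎
    (Σ (Subset n) λ B → ∣ B ∣ ≡ n ∸ a × minDeg≥ G B Lᴮ)
  balanced-partition budget δ≥D a≤n =
    let X₀ , X₀-size = ∃-count≡ a≤n in
    case descend cut (balanced-or-improvable budget δ≥D) X₀ X₀-size of λ where
      (X , X-size , inj₁ goodA) →
        inj₁ (tabulate X , trans (∣tabulate∣≡count X) X-size , minDeg≥-tabulate goodA)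
      (X , X-size , inj₂ goodB) →
        inj₂ (tabulate (not ∘ X) , ∣tabulate-not∣ X X-size , minDeg≥-tabulate goodB)

thresholds-sum : ∀ a b (t α : ℚ) →
  (ℕ→ℚ a * ½ - 1ℚ +ℚ α * t) +ℚ (ℕ→ℚ b * ½ - 1ℚ +ℚ (1ℚ - α) * t) +ℚ (1ℚ +ℚ ½)
  ≡ (ℕ→ℚ (a + b) - 1ℚ) * ½ +ℚ t
thresholds-sum a b t α rewrite ℕ→ℚ-+ a b =
  trans (identity (ℕ→ℚ a) (ℕ→ℚ b) t α ½) (ℚP.+-identityʳ _)
  where
  identity : ∀ A B t α h → (A * h - 1ℚ +ℚ α * t) +ℚ (B * h - 1ℚ +ℚ (1ℚ - α) * t) +ℚ (1ℚ +ℚ h)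
                           ≡ (A +ℚ B - 1ℚ) * h +ℚ t +ℚ (h +ℚ h - 1ℚ)
  identity = solve 5 (λ A B t α h →
    (A :* h :- con 1ℚ :+ α :* t) :+ (B :* h :- con 1ℚ :+ (con 1ℚ :- α) :* t) :+ (con 1ℚ :+ h)
    := (A :+ B :- con 1ℚ) :* h :+ t :+ (h :+ h :- con 1ℚ)) refl

lemma7 : (n : ℕ) (G : Graph n) (t α : ℚ) (a b : ℕ) →
    minDeg≥ G V ((ℕ→ℚ n - 1ℚ) * ½ +ℚ t) →
    0ℚ ≤ α → α ≤ 1ℚ →
    NonZero a → NonZero b → a + b ≡ n →
    (Σ (Subset n) λ A → ∣ A ∣ ≡ a ×
        minDeg≥ G A (ℕ→ℚ a * ½ - 1ℚ +ℚ α * t))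
    ⊎
    (Σ (Subset n) λ B → ∣ B ∣ ≡ b ×
        minDeg≥ G B (ℕ→ℚ b * ½ - 1ℚ +ℚ (1ℚ - α) * t))
lemma7 .(a + b) G t α a b δ≥D _ _ _ _ refl =
  map₂ (λ (B , B-size , B-good) → B , trans B-size (ℕP.m+n∸m≡n a b) , B-good)
       (balanced-partition G (ℚP.≤-reflexive (thresholds-sum a b t α)) δ≥D (ℕP.m≤m+n a b))
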